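{- Let $G=([n],E)$ be any simple undirected graph with vertex set $[n]$, and write $E=\{e_1>e_2>\dots>e_m\}$ with respect to a valid ordering $\le$ of $E$. Then the permutation $\tau(e_m)\tau(e_{m-1})\cdots\tau(e_1)\pi_0\in\mathcal{S}_{2n}$ does not depend on the choice of the valid ordering of $E$.
   Context: $[n]=\{1,\dots,n\}$; $\mathcal{S}_{2n}$ is the symmetric group on $[2n]$, with product of permutations meaning composition, $(\sigma\rho)(x)=\sigma(\rho(x))$; $(a,b)$ denotes a transposition. On the set $\binom{[n]}{2}$ of 2-element subsets define the partial order $\preceq$ by: for $a<b$ and $c<d$, $\{a,b\}\preceq\{c,d\}$ iff $c\le a<b\le d$. A valid ordering of a subset $E\subseteq\binom{[n]}{2}$ is a total order $\le$ on $E$ such that $e\preceq e'$ implies $e\le e'$ for all $e,e'\in E$. For $a<b$ let $\tau(\{a,b\})$ be the transposition $(2a,2b-1)$. Let $\pi_0=(1,2)(3,4)\cdots(2n-1,2n)$. -}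

module Defs where

open import Data.Nat using (ℕ; zero; suc; _+_; _*_; _∸_; _≤_; _<_)
open import Data.Nat.Base using (_≡ᵇ_; _≤ᵇ_; _%_)
open import Data.Bool using (Bool; true; false; if_then_else_)
open import Data.Product using (_×_; _,_; proj₁; proj₂)
open import Data.List using (List; []; _∷_; length; lookup; foldl)
open import Data.List.Relation.Unary.All using (All)
open import Data.List.Relation.Unary.Unique.Propositional using (Unique)
open import Data.List.Relation.Binary.Permutation.Propositional using (_↭_)
open import Data.Fin using (Fin; toℕ)
open import Relation.Binary.PropositionalEquality using (_≡_)

-- A 2-element subset {a,b} of [n] with a < b is represented by the pair (a , b).
Edge : Set
Edge = ℕ × ℕ

IsEdge : ℕ → Edge → Set
IsEdge n (a , b) = 1 ≤ a × a < b × b ≤ n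

_⪯_ : Edge → Edge → Set
(a , b) ⪯ (c , d) = c ≤ a × b ≤ d

record Graph (n : ℕ) : Set where
  field
    edges       : List Edge
    edgesValid  : All (IsEdge n) edges
    edgesUnique : Unique edges
open Graph public

-- A total order on E is encoded by the list L = [e₁ , e₂ , … , eₘ] of the
-- elements of E listed in DECREASING order (e₁ > e₂ > … > eₘ), i.e.
-- lookup L i ≤ lookup L j  iff  j ≤ i  (as indices).
-- It is a valid ordering iff  e ⪯ e'  implies  e ≤ e'.
record ValidOrdering {n : ℕ} (G : Graph n) (L : List Edge) : Set where
  field
    enumerates : L ↭ edges G
    respects   : ∀ (i j : Fin (length L)) →
                 lookup L i ⪯ lookup L j → toℕ j ≤ toℕ i
open ValidOrdering public

-- Permutations of [2n] are represented as functions ℕ → ℕ (acting on [2n]);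
-- product is composition: (σ ρ)(x) = σ (ρ x).

transp : ℕ → ℕ → ℕ → ℕ
transp a b x = if x ≡ᵇ a then b else (if x ≡ᵇ b then a else x)

τ : Edge → ℕ → ℕ
τ (a , b) = transp (2 * a) (2 * b ∸ 1)

-- π₀ = (1,2)(3,4)⋯(2n-1,2n) on [2n] (identity outside [2n]; 0 ↦ 0)
π₀ : ℕ → ℕ → ℕ
π₀ n zero = zero
π₀ n (suc y) = if suc y ≤ᵇ 2 * n
               then (if (y % 2) ≡ᵇ 0 then suc (suc y) else y)
               else suc y

-- For L = [e₁ , … , eₘ]:  prodPerm n L = τ(eₘ) τ(eₘ₋₁) ⋯ τ(e₁) π₀
-- i.e. x ↦ τ(eₘ) (⋯ (τ(e₁) (π₀ x)) ⋯).
prodPerm : ℕ → List Edge → ℕ → ℕ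
prodPerm n L x = foldl (λ y e → τ e y) (π₀ n x) L

{-# OPTIONS --safe #-}
module Submission where

-- Incomparable edges {a,b}, {c,d} have a ≠ c and b ≠ d, so τ of them swap the
-- disjoint pairs {2a, 2b−1} and {2c, 2d−1} and commute.  Two valid orderings
-- can disagree on the relative order of two edges only if the edges are
-- incomparable, so the first edge of one ordering can be commuted to the front
-- of the other, and induction on the number of edges finishes the argument.

open import Defs
open import Data.Nat using (ℕ; zero; suc; _+_; _*_; _∸_; _≤_; _<_; s≤s⁻¹)
open import Data.Nat.Properties using (_≟_; 1+n≢0; n≤0⇒n≡0; *-cancelˡ-≡; ≤-refl; ≤-total; +-suc; suc-injective; even≢odd)
open import Data.Product using (_×_; _,_; proj₁; proj₂)
open import Data.Sum using (inj₁; inj₂)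
open import Data.List using (List; []; _∷_; _++_; foldl; length; lookup)
open import Data.List.Properties using (foldl-++)
open import Data.List.Relation.Unary.Any using (here)
open import Data.List.Relation.Unary.All as All using (All; []; _∷_)
open import Data.List.Relation.Unary.All.Properties using (++⁻ˡ; ++⁻ʳ; ++⁺)
open import Data.List.Relation.Unary.AllPairs using (AllPairs; []; _∷_)
open import Data.List.Membership.Propositional.Properties using (∈-∃++; ∈-++⁺ˡ)
open import Data.List.Relation.Binary.Permutation.Propositional using (_↭_; ↭-sym; ↭-trans)
open import Data.List.Relation.Binary.Permutation.Propositional.Properties
  using (All-resp-↭; ∈-resp-↭; drop-mid; ↭-empty-inv)
open import Data.Fin using (Fin; toℕ) renaming (zero to fzero; suc to fsuc)
open import Relation.Nullary using (¬_; yes; no)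
open import Function using (_∘_)
open import Relation.Nullary.Decidable using (dec-true; dec-false)
open import Relation.Binary.PropositionalEquality using (_≡_; _≢_; ≢-sym; refl; trans; cong; module ≡-Reasoning)

open ≡-Reasoning

AllPairs-++-∷⁻ : ∀ {A : Set} {R : A → A → Set} xs {y ys} → AllPairs R (xs ++ y ∷ ys) →
                 AllPairs R (xs ++ ys) × All (λ x → R x y) xs
AllPairs-++-∷⁻ []       (_ ∷ pairs)        = pairs , []
AllPairs-++-∷⁻ (x ∷ xs) (x≺rest ∷ pairs) with AllPairs-++-∷⁻ xs pairs | ++⁻ʳ xs x≺rest
... | pairs′ , xs≺y | x≺y ∷ x≺ys = ++⁺ (++⁻ˡ xs x≺rest) x≺ys ∷ pairs′ , x≺y ∷ xs≺y

module FoldlAction {A X : Set} (act : A → X → X) where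

  run : X → List A → X
  run = foldl (λ x a → act a x)

  Commute : A → A → Set
  Commute a b = ∀ x → act a (act b x) ≡ act b (act a x)

  run-commute : ∀ {a} bs → All (Commute a) bs → ∀ x → act a (run x bs) ≡ run (act a x) bs
  run-commute []       []               x = refl
  run-commute (b ∷ bs) (ab ∷ a-commutes) x =
    trans (run-commute bs a-commutes (act b x)) (cong (λ y → run y bs) (ab x))

  -- a ≺ b reads "a may come before b"; only pairs that may come in either
  -- order are required to commute.
  run-↭ : {Ok : A → Set} {_≺_ : A → A → Set} →
          (∀ {a b} → Ok a → Ok b → a ≺ b → b ≺ a → Commute a b) →
          ∀ {as bs} → as ↭ bs → AllPairs _≺_ as → AllPairs _≺_ bs → All Ok bs →
          ∀ x → run x as ≡ run x bs
  run-↭ _ {[]} as↭bs _ _ _ x with refl ← ↭-empty-inv (↭-sym as↭bs) = refl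
  run-↭ {Ok} act-comm {a ∷ as} as↭bs (a≺as ∷ pairs-as) pairs-bs ok x
    with ps , qs , refl ← ∈-∃++ (∈-resp-↭ as↭bs (here refl))
    with pairs-ps++qs , ps≺a ← AllPairs-++-∷⁻ ps pairs-bs
    with okA ∷ okQs ← ++⁻ʳ ps ok = begin
      run (act a x) as             ≡⟨ run-↭ act-comm as↭ps++qs pairs-as pairs-ps++qs (++⁺ okPs okQs) (act a x) ⟩
      run (act a x) (ps ++ qs)     ≡⟨ foldl-++ _ (act a x) ps qs ⟩
      run (run (act a x) ps) qs    ≡⟨ cong (λ y → run y qs) (run-commute ps a-commutes x) ⟨
      run (act a (run x ps)) qs    ≡⟨ foldl-++ _ x ps (a ∷ qs) ⟨
      run x (ps ++ a ∷ qs)         ∎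
    where
    as↭ps++qs : as ↭ ps ++ qs
    as↭ps++qs = drop-mid [] ps as↭bs
    okPs : All Ok ps
    okPs = ++⁻ˡ ps ok
    a-commutes : All (Commute a) ps
    a-commutes = All.tabulate λ p∈ps →
      act-comm okA (All.lookup okPs p∈ps)
        (All.lookup a≺as (∈-resp-↭ (↭-sym as↭ps++qs) (∈-++⁺ˡ p∈ps)))
        (All.lookup ps≺a p∈ps)

open FoldlAction using (run-↭)

transp-ˡ : ∀ a b → transp a b a ≡ b
transp-ˡ a b rewrite dec-true (a ≟ a) refl = refl

transp-ʳ : ∀ {a b} → b ≢ a → transp a b b ≡ a
transp-ʳ {a} {b} b≢a rewrite dec-false (b ≟ a) b≢a | dec-true (b ≟ b) refl = refl

transp-fix : ∀ {a b x} → x ≢ a → x ≢ b → transp a b x ≡ x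
transp-fix {a} {b} {x} x≢a x≢b rewrite dec-false (x ≟ a) x≢a | dec-false (x ≟ b) x≢b = refl

transp-comm : ∀ {a b c d} → a ≢ c → a ≢ d → b ≢ c → b ≢ d →
              ∀ y → transp a b (transp c d y) ≡ transp c d (transp a b y)
transp-comm {a} {b} {c} {d} a≢c a≢d b≢c b≢d y with y ≟ a | y ≟ b | y ≟ c | y ≟ d
... | yes refl | _ | _ | _ = begin
  transp a b (transp c d a)  ≡⟨ cong (transp a b) (transp-fix a≢c a≢d) ⟩
  transp a b a               ≡⟨ transp-ˡ a b ⟩
  b                          ≡⟨ transp-fix b≢c b≢d ⟨
  transp c d b               ≡⟨ cong (transp c d) (transp-ˡ a b) ⟨
  transp c d (transp a b a)  ∎
... | no b≢a | yes refl | _ | _ = begin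
  transp a b (transp c d b)  ≡⟨ cong (transp a b) (transp-fix b≢c b≢d) ⟩
  transp a b b               ≡⟨ transp-ʳ b≢a ⟩
  a                          ≡⟨ transp-fix a≢c a≢d ⟨
  transp c d a               ≡⟨ cong (transp c d) (transp-ʳ b≢a) ⟨
  transp c d (transp a b b)  ∎
... | no c≢a | no c≢b | yes refl | _ = begin
  transp a b (transp c d c)  ≡⟨ cong (transp a b) (transp-ˡ c d) ⟩
  transp a b d               ≡⟨ transp-fix (≢-sym a≢d) (≢-sym b≢d) ⟩
  d                          ≡⟨ transp-ˡ c d ⟨
  transp c d c               ≡⟨ cong (transp c d) (transp-fix c≢a c≢b) ⟨
  transp c d (transp a b c)  ∎
... | no d≢a | no d≢b | no d≢c | yes refl = begin
  transp a b (transp c d d)  ≡⟨ cong (transp a b) (transp-ʳ d≢c) ⟩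
  transp a b c               ≡⟨ transp-fix (≢-sym a≢c) (≢-sym b≢c) ⟩
  c                          ≡⟨ transp-ʳ d≢c ⟨
  transp c d d               ≡⟨ cong (transp c d) (transp-fix d≢a d≢b) ⟨
  transp c d (transp a b d)  ∎
... | no y≢a | no y≢b | no y≢c | no y≢d = begin
  transp a b (transp c d y)  ≡⟨ cong (transp a b) (transp-fix y≢c y≢d) ⟩
  transp a b y               ≡⟨ transp-fix y≢a y≢b ⟩
  y                          ≡⟨ transp-fix y≢c y≢d ⟨
  transp c d y               ≡⟨ cong (transp c d) (transp-fix y≢a y≢b) ⟨
  transp c d (transp a b y)  ∎

_⋠_ : Edge → Edge → Set
e ⋠ e′ = ¬ e ⪯ e′

WellFormed : Edge → Set
WellFormed (a , b) = a < b

2*suc∸1 : ∀ b → 2 * suc b ∸ 1 ≡ suc (2 * b)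
2*suc∸1 b = +-suc b (b + 0)

even≢2*suc∸1 : ∀ a b → 2 * a ≢ 2 * suc b ∸ 1
even≢2*suc∸1 a b 2a≡2b-1 = even≢odd a b (trans 2a≡2b-1 (2*suc∸1 b))

τ-comm : ∀ {e e′} → WellFormed e → WellFormed e′ → e ⋠ e′ → e′ ⋠ e →
         ∀ y → τ e (τ e′ y) ≡ τ e′ (τ e y)
τ-comm {_ , zero} ()
τ-comm {_ , suc _} {_ , zero} _ ()
τ-comm {a , suc b} {c , suc d} _ _ e⋠e′ e′⋠e =
  transp-comm a≢c (even≢2*suc∸1 a d) (≢-sym (even≢2*suc∸1 c b)) b≢d
  where
  a≢c : 2 * a ≢ 2 * c
  a≢c 2a≡2c with refl ← *-cancelˡ-≡ a c 2 2a≡2c with ≤-total (suc b) (suc d)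
  ... | inj₁ b≤d = e⋠e′ (≤-refl , b≤d)
  ... | inj₂ d≤b = e′⋠e (≤-refl , d≤b)
  b≢d : 2 * suc b ∸ 1 ≢ 2 * suc d ∸ 1
  b≢d 2b-1≡2d-1 with refl ← *-cancelˡ-≡ b d 2 (suc-injective (begin
      suc (2 * b)    ≡⟨ 2*suc∸1 b ⟨
      2 * suc b ∸ 1  ≡⟨ 2b-1≡2d-1 ⟩
      2 * suc d ∸ 1  ≡⟨ 2*suc∸1 d ⟩
      suc (2 * d)    ∎)) with ≤-total a c
  ... | inj₁ a≤c = e′⋠e (a≤c , ≤-refl)
  ... | inj₂ c≤a = e⋠e′ (c≤a , ≤-refl)

All-tabulate-lookup : ∀ {A : Set} {P : A → Set} xs → (∀ i → P (lookup xs i)) → All P xs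
All-tabulate-lookup []       _ = []
All-tabulate-lookup (x ∷ xs) p = p fzero ∷ All-tabulate-lookup xs (p ∘ fsuc)

valid⇒AllPairs-⋠ : ∀ L → (∀ (i j : Fin (length L)) → lookup L i ⪯ lookup L j → toℕ j ≤ toℕ i) →
                   AllPairs _⋠_ L
valid⇒AllPairs-⋠ []      _        = []
valid⇒AllPairs-⋠ (e ∷ L) respects =
  All-tabulate-lookup L (λ j e⪯ → 1+n≢0 (n≤0⇒n≡0 (respects fzero (fsuc j) e⪯)))
  ∷ valid⇒AllPairs-⋠ L (λ i j ⪯ → s≤s⁻¹ (respects (fsuc i) (fsuc j) ⪯))

edges-wellFormed : ∀ {n} (G : Graph n) → All WellFormed (edges G)
edges-wellFormed G = All.map (proj₁ ∘ proj₂) (edgesValid G)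

mainTheorem2 : (n : ℕ) (G : Graph n) (L₁ L₂ : List Edge) →
               ValidOrdering G L₁ → ValidOrdering G L₂ →
               ∀ (x : ℕ) → 1 ≤ x → x ≤ 2 * n → prodPerm n L₁ x ≡ prodPerm n L₂ x
-- The two products agree on all of ℕ.
mainTheorem2 n G L₁ L₂ valid₁ valid₂ x _ _ =
  run-↭ τ τ-comm (↭-trans (enumerates valid₁) (↭-sym (enumerates valid₂)))
    (valid⇒AllPairs-⋠ L₁ (respects valid₁)) (valid⇒AllPairs-⋠ L₂ (respects valid₂))
    (All-resp-↭ (↭-sym (enumerates valid₂)) (edges-wellFormed G)) (π₀ n x)
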